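{- A finite graph $G$ is a Zykov graph if and only if every induced subgraph of $G$ contains a non-empty splitting stable set.
   Context: Zykov's construction: $Z_1$ is the graph with one vertex. Given $Z_1,\dots,Z_k$ ($k\ge 1$), the graph $Z_{k+1}$ is obtained by taking the disjoint union of $Z_1,\dots,Z_k$ and, for each $k$-tuple $(v_1,\dots,v_k)$ with $v_i\in V(Z_i)$, adding a new vertex adjacent exactly to $v_1,\dots,v_k$. A Zykov graph is any graph isomorphic to an induced subgraph of $Z_k$ for some integer $k\ge 1$. A stable set $A$ of a graph $G$ is splitting if every vertex of $A$ has at most one neighbor in each connected component of $G\setminus A$ (the graph obtained by deleting $A$). Here "induced subgraph" means induced subgraph on a non-empty vertex set. -}

module Defs where

open import Data.Nat using (ℕ; suc)
open import Data.Fin using (Fin; toℕ)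
open import Data.Fin.Subset using (Subset; _∈_; _∉_; _⊆_; Nonempty)
open import Data.Product using (Σ; ∃; _×_; _,_)
open import Relation.Nullary using (¬_; Dec)
open import Relation.Binary.PropositionalEquality using (_≡_)
open import Function.Definitions using (Injective)
open import Function.Bundles using (_⇔_)

record Graph : Set₁ where
  field
    n      : ℕ
    E      : Fin n → Fin n → Set
    E-dec  : ∀ x y → Dec (E x y)
    E-sym  : ∀ {x y} → E x y → E y x
    E-irr  : ∀ {x} → ¬ E x x

-- ZV k is the vertex set of Z_{k+1}.  A vertex of Z_{k+1} is either an
-- "old" vertex: a vertex of Z_{i+1} for some i < k (disjoint union of
-- Z_1, …, Z_k), or a "new" vertex: one per tuple (v_1,…,v_k) with
-- v_{i+1} ∈ V(Z_{i+1}).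

data ZV : ℕ → Set where
  old : ∀ {k} (i : Fin k) → ZV (toℕ i) → ZV k
  new : ∀ {k} → ((i : Fin k) → ZV (toℕ i)) → ZV k

data ZAdj : ∀ {k} → ZV k → ZV k → Set where
  oldE : ∀ {k} (i : Fin k) {u w : ZV (toℕ i)} → ZAdj u w → ZAdj {k} (old i u) (old i w)
  newL : ∀ {k} (t : (i : Fin k) → ZV (toℕ i)) (i : Fin k) → ZAdj {k} (new t) (old i (t i))
  newR : ∀ {k} (t : (i : Fin k) → ZV (toℕ i)) (i : Fin k) → ZAdj {k} (old i (t i)) (new t)

-- G is a Zykov graph: G is isomorphic to an induced subgraph of Z_{k+1}
-- for some k, i.e. there is an injective map V(G) → V(Z_{k+1}) that
-- preserves and reflects adjacency.
IsZykov : Graph → Set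
IsZykov G = ∃ λ (k : ℕ) → Σ (Fin n → ZV k) λ f →
              Injective _≡_ _≡_ f × (∀ x y → E x y ⇔ ZAdj (f x) (f y))
  where open Graph G

module _ (G : Graph) where
  open Graph G

  data Conn (P : Fin n → Set) : Fin n → Fin n → Set where
    here : ∀ {x} → P x → Conn P x x
    step : ∀ {x y z} → P x → E x y → Conn P y z → Conn P x z

  Rest : Subset n → Subset n → Fin n → Set
  Rest S A x = x ∈ S × x ∉ A

  IsStableIn : Subset n → Subset n → Set
  IsStableIn S A = A ⊆ S × (∀ {a b} → a ∈ A → b ∈ A → ¬ E a b)

  IsSplittingIn : Subset n → Subset n → Set
  IsSplittingIn S A =
    IsStableIn S A ×
    (∀ {a x y} → a ∈ A → Rest S A x → Rest S A y → E a x → E a y →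
       Conn (Rest S A) x y → x ≡ y)

  AllInducedHaveSplitting : Set
  AllInducedHaveSplitting =
    ∀ (S : Subset n) → Nonempty S →
      ∃ λ (A : Subset n) → Nonempty A × IsSplittingIn S A

-- A new vertex of Z_{k+1} has exactly one neighbour in each copy Z_{i+1}, i < k, and the new
-- vertices are pairwise non-adjacent.  So in an induced subgraph G[S] of Z_{k+1}, the new
-- vertices in S, if any, form a splitting set: a component of G[S] avoiding them lies in a
-- single copy.  If S has no new vertex, its part inside some copy Z_{i+1} is a union of
-- components of G[S], and a splitting set of that part, found by induction on k, splits G[S].
--
-- Conversely, let A split G[S].  By induction each component of G[S] ∖ A is an induced subgraph
-- of some Zykov graph; place these in distinct copies of one large Z_{K+1}.  A vertex a ∈ A
-- has at most one neighbour in each component, so it can be sent to the new vertex whose tuple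
-- picks that neighbour, or a vertex outside the image if there is none; one further coordinate
-- separates vertices of A with the same neighbourhood.

module Submission where

open import Defs
open import Data.Empty using (⊥-elim)
open import Data.Fin.Base using (Fin; zero; suc; toℕ; fromℕ<; inject≤; inject; Fin′; _↑ʳ_; splitAt; join; compare; less; equal; greater)
open import Data.Fin.Properties using (_≟_; any?; ¬∀⟶∃¬-smallest; toℕ<n; toℕ-fromℕ<; toℕ-↑ʳ; ↑ʳ-injective; suc-injective; splitAt-join; splitAt⁻¹-↑ʳ; inject≤-injective)
open import Data.Fin.Subset using (Subset; _∈_; _∉_; _⊆_; _⊂_; Nonempty; Empty; ⊤)
open import Data.Fin.Subset.Properties using (_∈?_; nonempty?; ∈⊤)
open import Data.Fin.Subset.Induction using (⊂-wellFounded)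
open import Data.List.Base using (map; allFin)
open import Data.List.Extrema.Nat using (max; ⊥≤max; xs≤max)
open import Data.List.Membership.Propositional.Properties using (∈-allFin)
import Data.List.Relation.Unary.All as All
open import Data.List.Relation.Unary.All.Properties using (map⁻)
open import Data.Nat.Base using (ℕ; zero; suc; s≤s; z≤n; _≤_; _<_; _≥_; _+_)
open import Data.Nat.Induction using (<-rec)
open import Data.Nat.Properties using (≤-trans; ≤-<-trans; m≤m+n; m<m+n)
open import Data.Product using (Σ; ∃; ∃-syntax; _×_; _,_; proj₁; proj₂)
open import Data.Sum using (_⊎_; inj₁; inj₂)
open import Data.Vec.Base using (tabulate)
open import Data.Vec.Properties using (lookup∘tabulate; []=⇒lookup; lookup⇒[]=)
open import Function using (_∘_)
open import Function.Bundles using (_⇔_; mk⇔; Equivalence)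
open import Induction.WellFounded using (module All)
import Function.Properties.Equivalence as ⇔
open import Relation.Nullary using (¬_; Dec; yes; no; does; contradiction; ¬?; _×-dec_)
open import Relation.Nullary.Decidable using (dec-true; decidable-stable; map′)
open import Relation.Binary.PropositionalEquality using (_≡_; _≢_; refl; sym; trans; cong; subst; subst₂)

open Equivalence using (to; from)

module _ {n} {P : Fin n → Set} (P? : ∀ x → Dec (P x)) where

  select : Subset n
  select = tabulate (λ x → does (P? x))

  ∈-select⁺ : ∀ {x} → P x → x ∈ select
  ∈-select⁺ {x} px = lookup⇒[]= x select (trans (lookup∘tabulate _ x) (dec-true (P? x) px))

  ∈-select⁻ : ∀ {x} → x ∈ select → P x
  ∈-select⁻ {x} x∈ with P? x | trans (sym (lookup∘tabulate (λ x → does (P? x)) x)) ([]=⇒lookup x∈)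
  ... | yes px | _ = px
  ... | no _ | ()

IsLeast : ∀ {n} → (Fin n → Set) → Fin n → Set
IsLeast P i = P i × ((j : Fin′ i) → ¬ P (inject j))

least : ∀ {n} {P : Fin n → Set} → (∀ x → Dec (P x)) → ∃ P → ∃ (IsLeast P)
least {n} {P} P? (x , px) with ¬∀⟶∃¬-smallest n (¬_ ∘ P) (¬? ∘ P?) (λ ¬P → ¬P x px)
... | i , ¬¬pi , below = i , decidable-stable (P? i) ¬¬pi , below

least-unique : ∀ {n} {P Q : Fin n → Set} {i j} → (∀ {x} → P x → Q x) → (∀ {x} → Q x → P x) →
               IsLeast P i → IsLeast Q j → i ≡ j
least-unique {i = i} {j} P⇒Q Q⇒P (pi , below-i) (qj , below-j) with compare i j
... | less _ k    = contradiction (P⇒Q pi) (below-j k)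
... | equal _     = refl
... | greater _ k = contradiction (Q⇒P qj) (below-i k)

ZAdj-sym : ∀ {k} {u w : ZV k} → ZAdj u w → ZAdj w u
ZAdj-sym (oldE i a) = oldE i (ZAdj-sym a)
ZAdj-sym (newL t i) = newR t i
ZAdj-sym (newR t i) = newL t i

module _ {k : ℕ} where

  data IsNew : ZV k → Set where
    isNew : ∀ t → IsNew (new t)

  data InCopy (i : Fin k) : ZV k → Set where
    inCopy : ∀ u → InCopy i (old i u)

  isNew? : ∀ v → Dec (IsNew v)
  isNew? (new t)   = yes (isNew t)
  isNew? (old _ _) = no λ ()

  inCopy? : ∀ i v → Dec (InCopy i v)
  inCopy? i (new _) = no λ ()
  inCopy? i (old j u) with j ≟ i
  ... | yes refl = yes (inCopy u)
  ... | no j≢i   = no λ { (inCopy _) → j≢i refl }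

  new-or-old : ∀ v → IsNew v ⊎ ∃[ i ] InCopy i v
  new-or-old (new t)   = inj₁ (isNew t)
  new-or-old (old i u) = inj₂ (i , inCopy u)

  new-stable : ∀ {u w} → IsNew u → IsNew w → ¬ ZAdj u w
  new-stable (isNew _) (isNew _) ()

  new-neighbour-unique : ∀ {u v w i} → IsNew u → ZAdj u v → ZAdj u w →
                         InCopy i v → InCopy i w → v ≡ w
  new-neighbour-unique (isNew t) (newL t i) (newL t i) (inCopy _) (inCopy _) = refl

  old-neighbour : ∀ {i u w} → InCopy i u → ZAdj u w → IsNew w ⊎ InCopy i w
  old-neighbour (inCopy _) (oldE i _) = inj₂ (inCopy _)
  old-neighbour (inCopy _) (newR t i) = inj₁ (isNew t)

  ZAdj-new-old : ∀ {t} {i : Fin k} {u} → ZAdj (new t) (old i u) ⇔ t i ≡ u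
  ZAdj-new-old = mk⇔ (λ { (newL t i) → refl }) (λ { refl → newL _ _ })

  ZAdj-old-old : ∀ {i : Fin k} {u w : ZV (toℕ i)} → ZAdj (old i u) (old i w) ⇔ ZAdj u w
  ZAdj-old-old = mk⇔ (λ { (oldE _ a) → a }) (oldE _)

  ZAdj-old⇒≡ : ∀ {i j : Fin k} {u w} → ZAdj (old i u) (old j w) → i ≡ j
  ZAdj-old⇒≡ (oldE _ _) = refl

  old-injectiveˡ : ∀ {i j : Fin k} {u w} → old i u ≡ old j w → i ≡ j
  old-injectiveˡ refl = refl

  old-injectiveʳ : ∀ {i : Fin k} {u w : ZV (toℕ i)} → old i u ≡ old i w → u ≡ w
  old-injectiveʳ refl = refl

  new-injective : ∀ {t s : (i : Fin k) → ZV (toℕ i)} → new t ≡ new s → t ≡ s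
  new-injective refl = refl

someVertex : ∀ k → ZV k
someVertex zero    = new λ ()
someVertex (suc k) = old zero (someVertex 0)

fresh : ∀ k → ZV k
fresh k = new λ i → someVertex (toℕ i)

project : ∀ {k} (i : Fin k) → ZV k → ZV (toℕ i)
project i v with inCopy? i v
... | yes (inCopy u) = u
... | no _        = someVertex (toℕ i)

project-old : ∀ {k i} {v : ZV k} → InCopy i v → v ≡ old i (project i v)
project-old {i = i} {v} c with inCopy? i v
... | yes (inCopy u) = refl
... | no ¬c       = contradiction c ¬c

-- Z_{j+1} is the copy in slot j of Z_{k+1}.
raise : ∀ {j k} → .(j < k) → ZV j → ZV k
raise j<k u = old (fromℕ< j<k) (subst ZV (sym (toℕ-fromℕ< j<k)) u)

module _ {j k : ℕ} .(j<k : j < k) where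

  private
    transport-injective : ∀ {a b} (e : a ≡ b) {u w : ZV a} → subst ZV e u ≡ subst ZV e w → u ≡ w
    transport-injective refl eq = eq

    transport-ZAdj : ∀ {a b} (e : a ≡ b) {u w : ZV a} → ZAdj (subst ZV e u) (subst ZV e w) ⇔ ZAdj u w
    transport-ZAdj refl = mk⇔ (λ a → a) (λ a → a)

  raise-injective : ∀ {u w} → raise j<k u ≡ raise j<k w → u ≡ w
  raise-injective = transport-injective _ ∘ old-injectiveʳ

  raise-ZAdj : ∀ {u w} → ZAdj (raise j<k u) (raise j<k w) ⇔ ZAdj u w
  raise-ZAdj = mk⇔ (to (transport-ZAdj _) ∘ to ZAdj-old-old) (from ZAdj-old-old ∘ from (transport-ZAdj _))

module _ (G : Graph) where
  open Graph G

  record Faithful {k} (S : Subset n) (φ : Fin n → ZV k) : Set where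
    field
      injective : ∀ {x y} → x ∈ S → y ∈ S → φ x ≡ φ y → x ≡ y
      edges     : ∀ {x y} → x ∈ S → y ∈ S → E x y ⇔ ZAdj (φ x) (φ y)

  ZykovOn : Subset n → Set
  ZykovOn S = ∃[ k ] Σ (Fin n → ZV k) (Faithful S)

  HasSplitting : Subset n → Set
  HasSplitting S = ∃[ A ] Nonempty A × IsSplittingIn G S A

  rest? : ∀ S A x → Dec (Rest G S A x)
  rest? S A x = x ∈? S ×-dec ¬? (x ∈? A)

  Conn-start : ∀ {P x y} → Conn G P x y → P x
  Conn-start (here px)     = px
  Conn-start (step px _ _) = px

  Conn-end : ∀ {P x y} → Conn G P x y → P y
  Conn-end (here py)    = py
  Conn-end (step _ _ c) = Conn-end c

  Conn-map : ∀ {P Q : Fin n → Set} → (∀ {z} → P z → Q z) → ∀ {x y} → Conn G P x y → Conn G Q x y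
  Conn-map f (here px)     = here (f px)
  Conn-map f (step px e c) = step (f px) e (Conn-map f c)

  Conn-trans : ∀ {P x y z} → Conn G P x y → Conn G P y z → Conn G P x z
  Conn-trans (here _)      d = d
  Conn-trans (step px e c) d = step px e (Conn-trans c d)

  Conn-sym : ∀ {P x y} → Conn G P x y → Conn G P y x
  Conn-sym (here px)     = here px
  Conn-sym (step px e c) = Conn-trans (Conn-sym c) (step (Conn-start c) (E-sym e) (here px))

  splitting-⊆-closed : ∀ {S S' A} → S' ⊆ S → (∀ {x z} → x ∈ S' → z ∈ S → E x z → z ∈ S') →
                       IsSplittingIn G S' A → IsSplittingIn G S A
  splitting-⊆-closed {S} {S'} {A} S'⊆S closed ((A⊆S' , stable) , split) =
    (S'⊆S ∘ A⊆S' , stable) ,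
    λ a∈A (x∈S , x∉A) (y∈S , y∉A) eax eay c →
      let x∈S' = closed (A⊆S' a∈A) x∈S eax
      in split a∈A (x∈S' , x∉A) (closed (A⊆S' a∈A) y∈S eay , y∉A) eax eay (inside x∈S' c)
    where
    inside : ∀ {x y} → x ∈ S' → Conn G (Rest G S A) x y → Conn G (Rest G S' A) x y
    inside x∈S' (here (_ , x∉A))      = here (x∈S' , x∉A)
    inside x∈S' (step (_ , x∉A) e c) =
      step (x∈S' , x∉A) e (inside (closed x∈S' (proj₁ (Conn-start c)) e) c)

  -- Splitting sets in induced subgraphs of Zykov graphs

  module _ {k} (φ : Fin n → ZV k) where

    newPart : Subset n → Subset n
    newPart S = select (λ x → x ∈? S ×-dec isNew? (φ x))

    copyPart : Fin k → Subset n → Subset n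
    copyPart i S = select (λ x → x ∈? S ×-dec inCopy? i (φ x))

    ∈-newPart⁻ : ∀ {S x} → x ∈ newPart S → x ∈ S × IsNew (φ x)
    ∈-newPart⁻ {S} = ∈-select⁻ (λ x → x ∈? S ×-dec isNew? (φ x))

    ∈-newPart⁺ : ∀ {S x} → x ∈ S → IsNew (φ x) → x ∈ newPart S
    ∈-newPart⁺ {S} x∈S isnew = ∈-select⁺ (λ x → x ∈? S ×-dec isNew? (φ x)) (x∈S , isnew)

    ∈-copyPart⁻ : ∀ {i S x} → x ∈ copyPart i S → x ∈ S × InCopy i (φ x)
    ∈-copyPart⁻ {i} {S} = ∈-select⁻ (λ x → x ∈? S ×-dec inCopy? i (φ x))

    ∈-copyPart⁺ : ∀ {i S x} → x ∈ S → InCopy i (φ x) → x ∈ copyPart i S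
    ∈-copyPart⁺ {i} {S} x∈S x∈i = ∈-select⁺ (λ x → x ∈? S ×-dec inCopy? i (φ x)) (x∈S , x∈i)

    module _ {S} (faithful : Faithful S φ) where
      open Faithful faithful

      private
        A = newPart S

        not-new : ∀ {x} → Rest G S A x → ¬ IsNew (φ x)
        not-new (x∈S , x∉A) isnew = x∉A (∈-newPart⁺ x∈S isnew)

        copy-along : ∀ {i x y} → Conn G (Rest G S A) x y → InCopy i (φ x) → InCopy i (φ y)
        copy-along (here _)         c = c
        copy-along (step rx exz cz) c
          with old-neighbour c (to (edges (proj₁ rx) (proj₁ (Conn-start cz))) exz)
        ... | inj₁ isnew = contradiction isnew (not-new (Conn-start cz))
        ... | inj₂ c′  = copy-along cz c′

      newPart-splitting : IsSplittingIn G S (newPart S)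
      newPart-splitting =
        (A⊆S , λ a∈A b∈A eab → new-stable (new-in a∈A) (new-in b∈A) (φ-adj a∈A (A⊆S b∈A) eab)) , split
        where
        A⊆S : A ⊆ S
        A⊆S = proj₁ ∘ ∈-newPart⁻
        new-in : ∀ {a} → a ∈ A → IsNew (φ a)
        new-in = proj₂ ∘ ∈-newPart⁻
        φ-adj : ∀ {a x} → a ∈ A → x ∈ S → E a x → ZAdj (φ a) (φ x)
        φ-adj a∈A x∈S = to (edges (A⊆S a∈A) x∈S)
        split : ∀ {a x y} → a ∈ A → Rest G S A x → Rest G S A y → E a x → E a y →
                Conn G (Rest G S A) x y → x ≡ y
        split a∈A rx ry eax eay c with new-or-old (φ _)
        ... | inj₁ isnew = contradiction isnew (not-new rx)
        ... | inj₂ (i , x∈i) =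
          injective (proj₁ rx) (proj₁ ry)
            (new-neighbour-unique (new-in a∈A) (φ-adj a∈A (proj₁ rx) eax) (φ-adj a∈A (proj₁ ry) eay)
                                  x∈i (copy-along c x∈i))

      module _ (noNew : Empty (newPart S)) (i : Fin k) where

        copyPart-closed : ∀ {x z} → x ∈ copyPart i S → z ∈ S → E x z → z ∈ copyPart i S
        copyPart-closed x∈ z∈S exz with ∈-copyPart⁻ x∈
        ... | x∈S , x∈i with old-neighbour x∈i (to (edges x∈S z∈S) exz)
        ... | inj₁ isnew = contradiction (_ , ∈-newPart⁺ z∈S isnew) noNew
        ... | inj₂ z∈i = ∈-copyPart⁺ z∈S z∈i

        copyPart-faithful : Faithful (copyPart i S) (project i ∘ φ)
        copyPart-faithful = record
          { injective = λ x∈ y∈ eq → injective (∈S x∈) (∈S y∈)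
              (trans (at x∈) (trans (cong (old i) eq) (sym (at y∈))))
          ; edges = λ {x} {y} x∈ y∈ → mk⇔
              (λ exy → to ZAdj-old-old (subst₂ ZAdj (at x∈) (at y∈) (to (edges (∈S x∈) (∈S y∈)) exy)))
              (λ a → from (edges (∈S x∈) (∈S y∈))
                          (subst₂ ZAdj (sym (at x∈)) (sym (at y∈)) (from ZAdj-old-old a)))
          }
          where
          ∈S : ∀ {x} → x ∈ copyPart i S → x ∈ S
          ∈S = proj₁ ∘ ∈-copyPart⁻
          at : ∀ {x} → x ∈ copyPart i S → φ x ≡ old i (project i (φ x))
          at = project-old ∘ proj₂ ∘ ∈-copyPart⁻

  FaithfulSplits : ℕ → Set
  FaithfulSplits k = ∀ (φ : Fin n → ZV k) {S} → Faithful S φ → Nonempty S → HasSplitting S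

  faithful-splits : ∀ k → FaithfulSplits k
  faithful-splits = <-rec FaithfulSplits go
    where
    go : ∀ k → (∀ {j} → j < k → FaithfulSplits j) → FaithfulSplits k
    go k rec φ {S} faithful (x , x∈S) with nonempty? (newPart φ S)
    ... | yes someNew = newPart φ S , someNew , newPart-splitting φ faithful
    ... | no noNew with new-or-old (φ x)
    ...   | inj₁ isnew    = contradiction (x , ∈-newPart⁺ φ x∈S isnew) noNew
    ...   | inj₂ (i , x∈i) with rec (toℕ<n i) (project i ∘ φ) (copyPart-faithful φ faithful noNew i)
                                    (x , ∈-copyPart⁺ φ x∈S x∈i)
    ...     | A , someA , split =
      A , someA , splitting-⊆-closed (proj₁ ∘ ∈-copyPart⁻ φ) (copyPart-closed φ faithful noNew i) split

  -- Connected components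

  private
    _∖_ : Subset n → Fin n → Subset n
    Q ∖ x = select (λ z → z ∈? Q ×-dec ¬? (z ≟ x))

    ∈-∖⁺ : ∀ {Q x z} → z ∈ Q → z ≢ x → z ∈ Q ∖ x
    ∈-∖⁺ {Q} {x} z∈Q z≢x = ∈-select⁺ (λ z → z ∈? Q ×-dec ¬? (z ≟ x)) (z∈Q , z≢x)

    ∈-∖⁻ : ∀ {Q x z} → z ∈ Q ∖ x → z ∈ Q × z ≢ x
    ∈-∖⁻ {Q} {x} = ∈-select⁻ (λ z → z ∈? Q ×-dec ¬? (z ≟ x))

    ∖-⊂ : ∀ {Q x} → x ∈ Q → Q ∖ x ⊂ Q
    ∖-⊂ x∈Q = proj₁ ∘ ∈-∖⁻ , _ , x∈Q , λ x∈ → proj₂ (∈-∖⁻ x∈) refl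

    -- Cut a path to y ≢ x after its last visit to x.
    last-exit : ∀ {Q x y z} → y ≢ x → Conn G (_∈ Q) z y →
                Conn G (_∈ Q ∖ x) z y ⊎ ∃[ w ] E x w × Conn G (_∈ Q ∖ x) w y
    last-exit y≢x (here y∈Q) = inj₁ (here (∈-∖⁺ y∈Q y≢x))
    last-exit {x = x} y≢x (step {x = z} z∈Q e c) with last-exit y≢x c
    ... | inj₂ exit = inj₂ exit
    ... | inj₁ c′ with z ≟ x
    ...   | yes refl = inj₂ (_ , e , c′)
    ...   | no z≢x   = inj₁ (step (∈-∖⁺ z∈Q z≢x) e c′)

    Conn-unstep : ∀ {Q x y} → x ≢ y → Conn G (_∈ Q) x y → ∃[ w ] E x w × Conn G (_∈ Q ∖ x) w y
    Conn-unstep x≢y c with last-exit (x≢y ∘ sym) c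
    ... | inj₁ c′  = contradiction refl (proj₂ (∈-∖⁻ (Conn-start c′)))
    ... | inj₂ exit = exit

  Conn-∈? : ∀ Q x y → Dec (Conn G (_∈ Q) x y)
  Conn-∈? = All.wfRec ⊂-wellFounded _ _ go
    where
    go : ∀ Q → (∀ {Q′} → Q′ ⊂ Q → ∀ x y → Dec (Conn G (_∈ Q′) x y)) →
         ∀ x y → Dec (Conn G (_∈ Q) x y)
    go Q rec x y with x ∈? Q | x ≟ y
    ... | no x∉Q | _        = no (x∉Q ∘ Conn-start)
    ... | yes x∈Q | yes refl = yes (here x∈Q)
    ... | yes x∈Q | no x≢y   =
      map′ (λ (w , e , c) → step x∈Q e (Conn-map (proj₁ ∘ ∈-∖⁻) c)) (Conn-unstep x≢y)
           (any? λ w → E-dec x w ×-dec rec (∖-⊂ x∈Q) w y)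

  Conn? : ∀ {P} → (∀ x → Dec (P x)) → ∀ x y → Dec (Conn G P x y)
  Conn? P? x y = map′ (Conn-map (∈-select⁻ P?)) (Conn-map (∈-select⁺ P?)) (Conn-∈? (select P?) x y)

  module Representative {P : Fin n → Set} (P? : ∀ x → Dec (P x)) where

    rep : Fin n → Fin n
    rep x with P? x
    ... | yes px = proj₁ (least (Conn? P? x) (x , here px))
    ... | no _   = x

    rep-least : ∀ {x} → P x → IsLeast (Conn G P x) (rep x)
    rep-least {x} px with P? x
    ... | yes px′ = proj₂ (least (Conn? P? x) (x , here px′))
    ... | no ¬px  = contradiction px ¬px

    rep-cong : ∀ {x y} → Conn G P x y → rep x ≡ rep y
    rep-cong c = least-unique (λ {z} → Conn-trans {z = z} (Conn-sym c))
                              (λ {z} → Conn-trans {z = z} c)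
                              (rep-least (Conn-start c)) (rep-least (Conn-end c))

    rep-conn : ∀ {x y} → P x → P y → rep x ≡ rep y → Conn G P x y
    rep-conn px py eq =
      Conn-trans (proj₁ (rep-least px)) (subst (λ r → Conn G P r _) (sym eq) (Conn-sym (proj₁ (rep-least py))))

  -- Gluing Zykov embeddings along a splitting set

  record Decomposition (S : Subset n) : Set where
    field
      A            : Subset n
      label        : Fin n → Fin n
      A⊆S          : A ⊆ S
      A-stable     : ∀ {a b} → a ∈ A → b ∈ A → ¬ E a b
      label-edge   : ∀ {x y} → Rest G S A x → Rest G S A y → E x y → label x ≡ label y
      label-unique : ∀ {a x y} → a ∈ A → Rest G S A x → Rest G S A y → E a x → E a y →
                     label x ≡ label y → x ≡ y

    part : Fin n → Subset n
    part c = select (λ x → rest? S A x ×-dec (label x ≟ c))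

    ∈-part⁺ : ∀ {c x} → Rest G S A x → label x ≡ c → x ∈ part c
    ∈-part⁺ {c} rx eq = ∈-select⁺ (λ x → rest? S A x ×-dec (label x ≟ c)) (rx , eq)

    ∈-part⁻ : ∀ {c x} → x ∈ part c → Rest G S A x × label x ≡ c
    ∈-part⁻ {c} = ∈-select⁻ (λ x → rest? S A x ×-dec (label x ≟ c))

    edge-within-part : ∀ {c c′ x y} → x ∈ part c → y ∈ part c′ → E x y → c ≡ c′
    edge-within-part x∈ y∈ exy with ∈-part⁻ x∈ | ∈-part⁻ y∈
    ... | rx , refl | ry , refl = label-edge rx ry exy

    part-neighbour-unique : ∀ {a c x y} → a ∈ A → x ∈ part c → y ∈ part c → E a x → E a y → x ≡ y
    part-neighbour-unique a∈A x∈ y∈ eax eay with ∈-part⁻ x∈ | ∈-part⁻ y∈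
    ... | rx , refl | ry , eq = label-unique a∈A rx ry eax eay (sym eq)

    part-⊂ : Nonempty A → ∀ c → part c ⊂ S
    part-⊂ (a , a∈A) c =
      proj₁ ∘ proj₁ ∘ ∈-part⁻ , a , A⊆S a∈A , λ a∈c → proj₂ (proj₁ (∈-part⁻ a∈c)) a∈A

  decomposition : ∀ {S A} → IsSplittingIn G S A → Decomposition S
  decomposition {S} {A} ((A⊆S , stable) , split) = record
    { A            = A
    ; label        = rep
    ; A⊆S          = A⊆S
    ; A-stable     = stable
    ; label-edge   = λ rx ry exy → rep-cong (step rx exy (here ry))
    ; label-unique = λ a∈A rx ry eax eay eq → split a∈A rx ry eax eay (rep-conn rx ry eq)
    }
    where open Representative (rest? S A)

  module Glue {S} (D : Decomposition S) (embed : ∀ c → ZykovOn (Decomposition.part D c)) where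
    open Decomposition D

    private
      level : Fin n → ℕ
      level c = proj₁ (embed c)

      φ : ∀ c → Fin n → ZV (level c)
      φ c = proj₁ (proj₂ (embed c))

      module φ c = Faithful (proj₂ (proj₂ (embed c)))

    -- Slot M + 1 + c of Z_{K+1} hosts the embedding of part c, so M bounds the levels of the parts;
    -- slot M tags the vertices of A, which may have equal neighbourhoods, so M ≥ n.
    M : ℕ
    M = max n (map level (allFin n))

    K : ℕ
    K = M + suc n

    n≤M : n ≤ M
    n≤M = ⊥≤max n (map level (allFin n))

    level≤M : ∀ c → level c ≤ M
    level≤M c = All.lookup (map⁻ (xs≤max n (map level (allFin n)))) (∈-allFin c)

    tagSlot-level : n ≤ toℕ (M ↑ʳ zero {n})
    tagSlot-level = subst (n ≤_) (sym (toℕ-↑ʳ M zero)) (≤-trans n≤M (m≤m+n M 0))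

    partSlot-level : ∀ c → level c < toℕ (M ↑ʳ suc {n} c)
    partSlot-level c =
      subst (level c <_) (sym (toℕ-↑ʳ M (suc c))) (≤-<-trans (level≤M c) (m<m+n M (s≤s z≤n)))

    tag : ∀ {j} → Fin n → .(n ≤ j) → ZV j
    tag a n≤j = old (inject≤ a n≤j) (someVertex _)

    -- fresh is a new vertex, hence outside the image of raise.
    neighbour : ∀ {j} → Fin n → (c : Fin n) → .(level c < j) → ZV j
    neighbour a c lt with any? (λ z → z ∈? part c ×-dec E-dec a z)
    ... | yes (z , _) = raise lt (φ c z)
    ... | no _        = fresh _

    entry : Fin n → (i : Fin K) (s : Fin M ⊎ Fin (suc n)) → splitAt M i ≡ s → ZV (toℕ i)
    entry a i (inj₁ _)       _ = someVertex (toℕ i)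
    entry a i (inj₂ zero)    e = tag a (subst (λ i → n ≤ toℕ i) (splitAt⁻¹-↑ʳ e) tagSlot-level)
    entry a i (inj₂ (suc c)) e =
      neighbour a c (subst (λ i → level c < toℕ i) (splitAt⁻¹-↑ʳ e) (partSlot-level c))

    tuple : Fin n → (i : Fin K) → ZV (toℕ i)
    tuple a i = entry a i (splitAt M i) refl

    tuple-join : ∀ a s → tuple a (join M (suc n) s) ≡ entry a _ s (splitAt-join M (suc n) s)
    tuple-join a s = irrelevant refl (splitAt-join M (suc n) s)
      where
      irrelevant : ∀ {i s s′} (e : splitAt M i ≡ s) (e′ : splitAt M i ≡ s′) →
                   entry a i s e ≡ entry a i s′ e′
      irrelevant refl refl = refl

    tuple-injective : ∀ {a b} → tuple a ≡ tuple b → a ≡ b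
    tuple-injective {a} {b} eq = inject≤-injective _ _ a b (old-injectiveˡ tags-agree)
      where
      tags-agree : tag a _ ≡ tag b _
      tags-agree = trans (sym (tuple-join a (inj₂ zero)))
                         (trans (cong (λ t → t (M ↑ʳ zero)) eq) (tuple-join b (inj₂ zero)))

    neighbour-edge : ∀ {a c y j} .(lt : level c < j) → a ∈ A → y ∈ part c →
                     E a y ⇔ (neighbour a c lt ≡ raise lt (φ c y))
    neighbour-edge {a} {c} {y} lt a∈A y∈c with any? (λ z → z ∈? part c ×-dec E-dec a z)
    ... | yes (z , z∈c , eaz) = mk⇔
          (λ eay → cong (raise lt ∘ φ c) (part-neighbour-unique a∈A z∈c y∈c eaz eay))
          (λ eq → subst (E a) (φ.injective c z∈c y∈c (raise-injective lt eq)) eaz)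
    ... | no none = mk⇔ (λ eay → contradiction (y , y∈c , eay) none) (λ ())

    partVertex : Fin n → Fin n → ZV K
    partVertex c x = old (M ↑ʳ suc c) (raise (partSlot-level c) (φ c x))

    partSlot-injective : ∀ {c c′ : Fin n} → M ↑ʳ suc c ≡ M ↑ʳ suc c′ → c ≡ c′
    partSlot-injective = suc-injective ∘ ↑ʳ-injective M _ _

    partVertex-injective : ∀ {c c′ x y} → x ∈ part c → y ∈ part c′ →
                           partVertex c x ≡ partVertex c′ y → x ≡ y
    partVertex-injective {c} x∈ y∈ eq with partSlot-injective (old-injectiveˡ eq)
    ... | refl = φ.injective c x∈ y∈ (raise-injective _ (old-injectiveʳ eq))

    partVertex-edge⁺ : ∀ {c c′ x y} → x ∈ part c → y ∈ part c′ →
                       E x y → ZAdj (partVertex c x) (partVertex c′ y)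
    partVertex-edge⁺ {c} x∈ y∈ exy with edge-within-part x∈ y∈ exy
    ... | refl = from ZAdj-old-old (from (raise-ZAdj _) (to (φ.edges c x∈ y∈) exy))

    partVertex-edge⁻ : ∀ {c c′ x y} → x ∈ part c → y ∈ part c′ →
                       ZAdj (partVertex c x) (partVertex c′ y) → E x y
    partVertex-edge⁻ {c} x∈ y∈ adj with partSlot-injective (ZAdj-old⇒≡ adj)
    ... | refl = from (φ.edges c x∈ y∈) (to (raise-ZAdj _) (to ZAdj-old-old adj))

    tuple-edge : ∀ {a y} → a ∈ A → Rest G S A y → E a y ⇔ ZAdj (new (tuple a)) (partVertex (label y) y)
    tuple-edge {a} {y} a∈A ry =
      ⇔.trans (neighbour-edge _ a∈A (∈-part⁺ ry refl)) (⇔.trans read-slot (⇔.sym ZAdj-new-old))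
      where
      slot-value = tuple-join a (inj₂ (suc (label y)))
      read-slot : ∀ {u} → (neighbour a (label y) _ ≡ u) ⇔ (tuple a (M ↑ʳ suc (label y)) ≡ u)
      read-slot = mk⇔ (trans slot-value) (trans (sym slot-value))

    ψ : Fin n → ZV K
    ψ x with x ∈? A
    ... | yes _ = new (tuple x)
    ... | no _  = partVertex (label x) x

    ψ-faithful : Faithful S ψ
    ψ-faithful = record { injective = injective ; edges = edges }
      where
      injective : ∀ {x y} → x ∈ S → y ∈ S → ψ x ≡ ψ y → x ≡ y
      injective {x} {y} x∈S y∈S with x ∈? A | y ∈? A
      ... | yes _   | yes _   = tuple-injective ∘ new-injective
      ... | yes _   | no _    = λ ()
      ... | no _    | yes _   = λ ()
      ... | no x∉A  | no y∉A  =
        partVertex-injective (∈-part⁺ (x∈S , x∉A) refl) (∈-part⁺ (y∈S , y∉A) refl)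

      edges : ∀ {x y} → x ∈ S → y ∈ S → E x y ⇔ ZAdj (ψ x) (ψ y)
      edges {x} {y} x∈S y∈S with x ∈? A | y ∈? A
      ... | yes x∈A | yes y∈A = mk⇔ (⊥-elim ∘ A-stable x∈A y∈A) (λ ())
      ... | yes x∈A | no y∉A  = tuple-edge x∈A (y∈S , y∉A)
      ... | no x∉A  | yes y∈A = mk⇔ (ZAdj-sym ∘ to (tuple-edge y∈A (x∈S , x∉A)) ∘ E-sym)
                                    (E-sym ∘ from (tuple-edge y∈A (x∈S , x∉A)) ∘ ZAdj-sym)
      ... | no x∉A  | no y∉A  = mk⇔ (partVertex-edge⁺ x∈ y∈) (partVertex-edge⁻ x∈ y∈)
        where
        x∈ = ∈-part⁺ (x∈S , x∉A) refl
        y∈ = ∈-part⁺ (y∈S , y∉A) refl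

    glue : ZykovOn S
    glue = K , ψ , ψ-faithful

  zykovOn : AllInducedHaveSplitting G → ∀ S → ZykovOn S
  zykovOn splits = All.wfRec ⊂-wellFounded _ ZykovOn go
    where
    go : ∀ S → (∀ {S′} → S′ ⊂ S → ZykovOn S′) → ZykovOn S
    go S rec with nonempty? S
    ... | no empty = 0 , (λ _ → someVertex 0) , record
          { injective = λ x∈S _ _ → contradiction (_ , x∈S) empty
          ; edges     = λ x∈S _ → contradiction (_ , x∈S) empty
          }
    ... | yes someS with splits S someS
    ...   | A , someA , splitting = Glue.glue D (rec ∘ Decomposition.part-⊂ D someA)
      where D = decomposition splitting

  zykov⇒splitting : IsZykov G → AllInducedHaveSplitting G
  zykov⇒splitting (k , f , inj , adj) S =
    faithful-splits k f (record { injective = λ _ _ → inj ; edges = λ {x} {y} _ _ → adj x y })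

  splitting⇒zykov : AllInducedHaveSplitting G → IsZykov G
  splitting⇒zykov splits with zykovOn splits ⊤
  ... | k , f , faithful = k , f , injective ∈⊤ ∈⊤ , λ x y → edges ∈⊤ ∈⊤
    where open Faithful faithful

-- Both sides hold for the empty graph.
theorem1 : (G : Graph) → Graph.n G ≥ 1 → (IsZykov G ⇔ AllInducedHaveSplitting G)
theorem1 G _ = mk⇔ (zykov⇒splitting G) (splitting⇒zykov G)
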